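{- The cycle graph $C_7$ of length $7$ is not strongly $\ell$-walk-regular for any integer $\ell\ge2$; that is, $C_7$ is not strongly walk-regular.
   Context: Let $A$ be the adjacency matrix of a finite simple graph and $J$ the all-ones matrix. For an integer $\ell\ge2$, the graph is strongly $\ell$-walk-regular if $A^\ell$ is a linear combination of $I$, $A$ and $J$; it is strongly walk-regular if it is strongly $\ell$-walk-regular for some $\ell\ge2$. -}

module Defs where

open import Data.Nat using (ℕ; zero; suc)
import Data.Nat as ℕ
open import Data.Fin as F using (Fin; toℕ)
open import Data.Bool using (Bool; true; false; if_then_else_; _∨_)
open import Data.Rational using (ℚ; 0ℚ; 1ℚ; _+_; _*_)
open import Data.Product using (∃-syntax; _×_)
open import Relation.Binary.PropositionalEquality using (_≡_)
open import Relation.Nullary.Decidable using (⌊_⌋)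

Matrix : ℕ → Set
Matrix n = Fin n → Fin n → ℚ

Σ : (n : ℕ) → (Fin n → ℚ) → ℚ
Σ zero    f = 0ℚ
Σ (suc n) f = f F.zero + Σ n (λ i → f (F.suc i))

_⊗_ : ∀ {n} → Matrix n → Matrix n → Matrix n
(M ⊗ N) i j = Σ _ (λ k → M i k * N k j)

I : ∀ {n} → Matrix n
I i j = if ⌊ i F.≟ j ⌋ then 1ℚ else 0ℚ

J : ∀ {n} → Matrix n
J i j = 1ℚ

_^_ : ∀ {n} → Matrix n → ℕ → Matrix n
M ^ zero  = I
M ^ suc ℓ = M ⊗ (M ^ ℓ)

-- adjacency matrix of the cycle C_(k+3) (k+3 ≥ 3 vertices 0..k+2):
-- i ~ j iff j ≡ i+1 or i ≡ j+1 (mod k+3)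
cycleAdj : (k : ℕ) → Matrix (3 ℕ.+ k)
cycleAdj k i j =
  if ⌊ succMod i ℕ.≟ toℕ j ⌋ ∨ ⌊ succMod j ℕ.≟ toℕ i ⌋ then 1ℚ else 0ℚ
  where
  succMod : Fin (3 ℕ.+ k) → ℕ
  succMod x = suc (toℕ x) ℕ.% (3 ℕ.+ k)

C7 : Matrix 7
C7 = cycleAdj 4

StronglyWalkRegularAt : ∀ {n} → Matrix n → ℕ → Set
StronglyWalkRegularAt A ℓ =
  ∃[ a ] ∃[ b ] ∃[ c ] (∀ i j → (A ^ ℓ) i j ≡ a * I i j + b * A i j + c * J i j)

-- Walks of length ℓ from vertex 0 of C₇ to vertex i depend only on the cyclic
-- distance d ∈ {0,1,2,3} of i from 0, and these four counts obey
-- (w₀,w₁,w₂,w₃) ↦ (2w₁, w₀+w₂, w₁+w₃, w₂+w₃).  From ℓ = 2 on they alternate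
-- between the orderings w₁ ≤ w₃ < w₂ ≤ w₀ and w₀ ≤ w₂ < w₃ ≤ w₁, so w₂ ≠ w₃.
-- But vertices 2 and 3 are both non-adjacent and distinct from 0, so
-- A^ℓ = aI + bA + cJ would force (A^ℓ)₂₀ = (A^ℓ)₃₀.
module Submission where

open import Defs
open import Data.Nat using (ℕ; _≥_)
open import Relation.Nullary using (¬_)

open import Data.Bool using (true; false; if_then_else_; _∨_)
open import Data.Fin using (Fin; toℕ; zero; suc; _≟_; #_)
open import Data.Nat as ℕ using (zero; suc; z≤n; s≤s; _≤_; _<_; _%_)
import Data.Nat.Properties as ℕ
open import Data.Nat.Coprimality using (1-coprimeTo) renaming (sym to coprime-sym)
open import Data.Nat.Tactic.RingSolver using (solve-∀)
open import Data.Integer as ℤ using (+_)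
import Data.Integer.Properties as ℤ
open import Data.Rational as ℚ using (ℚ; mkℚ)
import Data.Rational.Properties as ℚ
import Data.Rational.Unnormalised as ℚᵘ
import Data.Rational.Unnormalised.Properties as ℚᵘ
open import Data.Product using (_,_; _×_)
open import Data.Sum using (_⊎_; inj₁; inj₂)
open import Relation.Binary.PropositionalEquality using (_≡_; _≢_; refl; sym; trans; cong; cong₂; module ≡-Reasoning)
open import Relation.Nullary.Decidable using (⌊_⌋)
open import Algebra.Properties.Monoid.Sum ℕ.+-0-monoid using (sum; sum-cong-≗)

fromℕ : ℕ → ℚ
fromℕ n = mkℚ (+ n) 0 (coprime-sym (1-coprimeTo n))

fromℕ-injective : ∀ {m n} → fromℕ m ≡ fromℕ n → m ≡ n
fromℕ-injective eq = ℤ.+-injective (cong ℚ.ℚ.numerator eq)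

fromℕ-homo-+ : ∀ m n → fromℕ (m ℕ.+ n) ≡ fromℕ m ℚ.+ fromℕ n
fromℕ-homo-+ m n = ℚ.toℚᵘ-injective
  (ℚᵘ.≃-trans (ℚᵘ.*≡* numerators) (ℚᵘ.≃-sym (ℚ.toℚᵘ-homo-+ (fromℕ m) (fromℕ n))))
  where
  numerators : + (m ℕ.+ n) ℤ.* + 1 ≡ (+ m ℤ.* + 1 ℤ.+ + n ℤ.* + 1) ℤ.* + 1
  numerators = begin
    + (m ℕ.+ n) ℤ.* + 1                    ≡⟨ ℤ.*-identityʳ _ ⟩
    + (m ℕ.+ n)                            ≡⟨ ℤ.pos-+ m n ⟩
    + m ℤ.+ + n                            ≡⟨ cong₂ ℤ._+_ (ℤ.*-identityʳ (+ m)) (ℤ.*-identityʳ (+ n)) ⟨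
    + m ℤ.* + 1 ℤ.+ + n ℤ.* + 1            ≡⟨ ℤ.*-identityʳ _ ⟨
    (+ m ℤ.* + 1 ℤ.+ + n ℤ.* + 1) ℤ.* + 1  ∎
    where open ≡-Reasoning

fromℕ-homo-* : ∀ m n → fromℕ (m ℕ.* n) ≡ fromℕ m ℚ.* fromℕ n
fromℕ-homo-* m n = ℚ.toℚᵘ-injective
  (ℚᵘ.≃-trans (ℚᵘ.*≡* numerators) (ℚᵘ.≃-sym (ℚ.toℚᵘ-homo-* (fromℕ m) (fromℕ n))))
  where
  numerators : + (m ℕ.* n) ℤ.* + 1 ≡ (+ m ℤ.* + n) ℤ.* + 1
  numerators = cong (ℤ._* + 1) (ℤ.pos-* m n)

fromℕ-if : ∀ b m n → fromℕ (if b then m else n) ≡ (if b then fromℕ m else fromℕ n)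
fromℕ-if true  m n = refl
fromℕ-if false m n = refl

Σ-fromℕ : ∀ n (f : Fin n → ℚ) (g : Fin n → ℕ) →
          (∀ k → f k ≡ fromℕ (g k)) → Σ n f ≡ fromℕ (sum g)
Σ-fromℕ zero    f g f≡g = refl
Σ-fromℕ (suc n) f g f≡g = begin
  f zero ℚ.+ Σ n (λ k → f (suc k))                  ≡⟨ cong₂ ℚ._+_ (f≡g zero) (Σ-fromℕ n _ _ (λ k → f≡g (suc k))) ⟩
  fromℕ (g zero) ℚ.+ fromℕ (sum (λ k → g (suc k)))  ≡⟨ fromℕ-homo-+ (g zero) _ ⟨
  fromℕ (sum g)                                     ∎
  where open ≡-Reasoning

Matrixℕ : ℕ → Set
Matrixℕ n = Fin n → Fin n → ℕ

_⊗ℕ_ : ∀ {n} → Matrixℕ n → Matrixℕ n → Matrixℕ n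
(M ⊗ℕ N) i j = sum (λ k → M i k ℕ.* N k j)

Iℕ : ∀ {n} → Matrixℕ n
Iℕ i j = if ⌊ i ≟ j ⌋ then 1 else 0

_^ℕ_ : ∀ {n} → Matrixℕ n → ℕ → Matrixℕ n
M ^ℕ zero  = Iℕ
M ^ℕ suc ℓ = M ⊗ℕ (M ^ℕ ℓ)

fromℕ-homo-^ : ∀ {n} (A : Matrix n) (B : Matrixℕ n) → (∀ i j → A i j ≡ fromℕ (B i j)) →
               ∀ ℓ i j → (A ^ ℓ) i j ≡ fromℕ ((B ^ℕ ℓ) i j)
fromℕ-homo-^ A B A≡B zero    i j = sym (fromℕ-if ⌊ i ≟ j ⌋ 1 0)
fromℕ-homo-^ A B A≡B (suc ℓ) i j = Σ-fromℕ _ _ _ λ k → begin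
  A i k ℚ.* (A ^ ℓ) k j                     ≡⟨ cong₂ ℚ._*_ (A≡B i k) (fromℕ-homo-^ A B A≡B ℓ k j) ⟩
  fromℕ (B i k) ℚ.* fromℕ ((B ^ℕ ℓ) k j)    ≡⟨ sym (fromℕ-homo-* (B i k) _) ⟩
  fromℕ (B i k ℕ.* (B ^ℕ ℓ) k j)            ∎
  where open ≡-Reasoning

StronglyWalkRegularAt⇒power-agrees : ∀ {n} {A : Matrix n} {ℓ} → StronglyWalkRegularAt A ℓ →
  ∀ i j k → I i k ≡ I j k → A i k ≡ A j k → (A ^ ℓ) i k ≡ (A ^ ℓ) j k
StronglyWalkRegularAt⇒power-agrees {A = A} {ℓ} (a , b , c , Aˡ≡) i j k Iᵢ≡Iⱼ Aᵢ≡Aⱼ = begin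
  (A ^ ℓ) i k                                  ≡⟨ Aˡ≡ i k ⟩
  a ℚ.* I i k ℚ.+ b ℚ.* A i k ℚ.+ c ℚ.* J i k  ≡⟨ cong₂ (λ x y → a ℚ.* x ℚ.+ b ℚ.* y ℚ.+ c ℚ.* ℚ.1ℚ) Iᵢ≡Iⱼ Aᵢ≡Aⱼ ⟩
  a ℚ.* I j k ℚ.+ b ℚ.* A j k ℚ.+ c ℚ.* J j k  ≡⟨ sym (Aˡ≡ j k) ⟩
  (A ^ ℓ) j k                                  ∎
  where open ≡-Reasoning

C7ℕ : Matrixℕ 7
C7ℕ i j = if ⌊ suc (toℕ i) % 7 ℕ.≟ toℕ j ⌋ ∨ ⌊ suc (toℕ j) % 7 ℕ.≟ toℕ i ⌋ then 1 else 0

C7≡C7ℕ : ∀ i j → C7 i j ≡ fromℕ (C7ℕ i j)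
C7≡C7ℕ i j = sym (fromℕ-if _ 1 0)

-- at-d counts the walks from vertex 0 to a vertex at cyclic distance d from 0;
-- atVertex spreads them back over the seven vertices.
record WalkCounts : Set where
  constructor walkCounts
  field
    at-0 at-1 at-2 at-3 : ℕ
open WalkCounts

next : WalkCounts → WalkCounts
next (walkCounts w₀ w₁ w₂ w₃) = walkCounts (w₁ ℕ.+ w₁) (w₀ ℕ.+ w₂) (w₁ ℕ.+ w₃) (w₂ ℕ.+ w₃)

walks : ℕ → WalkCounts
walks zero    = walkCounts 1 0 0 0
walks (suc ℓ) = next (walks ℓ)

atVertex : WalkCounts → Fin 7 → ℕ
atVertex w zero                                     = at-0 w
atVertex w (suc zero)                               = at-1 w
atVertex w (suc (suc zero))                         = at-2 w
atVertex w (suc (suc (suc zero)))                   = at-3 w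
atVertex w (suc (suc (suc (suc zero))))             = at-3 w
atVertex w (suc (suc (suc (suc (suc zero)))))       = at-2 w
atVertex w (suc (suc (suc (suc (suc (suc zero)))))) = at-1 w

-- Each row of C7ℕ has exactly two ones, so a row-times-column sum reduces to this shape.
two-neighbours : ∀ x y → (x ℕ.+ 0) ℕ.+ ((y ℕ.+ 0) ℕ.+ 0) ≡ x ℕ.+ y
two-neighbours = solve-∀

next-atVertex : ∀ w i → sum (λ k → C7ℕ i k ℕ.* atVertex w k) ≡ atVertex (next w) i
next-atVertex (walkCounts w₀ w₁ w₂ w₃) zero                   = two-neighbours w₁ w₁
next-atVertex (walkCounts w₀ w₁ w₂ w₃) (suc zero)             = two-neighbours w₀ w₂
next-atVertex (walkCounts w₀ w₁ w₂ w₃) (suc (suc zero))       = two-neighbours w₁ w₃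
next-atVertex (walkCounts w₀ w₁ w₂ w₃) (suc (suc (suc zero))) = two-neighbours w₂ w₃
next-atVertex (walkCounts w₀ w₁ w₂ w₃) (suc (suc (suc (suc zero)))) =
  trans (two-neighbours w₃ w₂) (ℕ.+-comm w₃ w₂)
next-atVertex (walkCounts w₀ w₁ w₂ w₃) (suc (suc (suc (suc (suc zero))))) =
  trans (two-neighbours w₃ w₁) (ℕ.+-comm w₃ w₁)
next-atVertex (walkCounts w₀ w₁ w₂ w₃) (suc (suc (suc (suc (suc (suc zero)))))) =
  two-neighbours w₀ w₂

C7ℕ-power-column : ∀ ℓ i → (C7ℕ ^ℕ ℓ) i zero ≡ atVertex (walks ℓ) i
C7ℕ-power-column zero zero                                     = refl
C7ℕ-power-column zero (suc zero)                               = refl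
C7ℕ-power-column zero (suc (suc zero))                         = refl
C7ℕ-power-column zero (suc (suc (suc zero)))                   = refl
C7ℕ-power-column zero (suc (suc (suc (suc zero))))             = refl
C7ℕ-power-column zero (suc (suc (suc (suc (suc zero)))))       = refl
C7ℕ-power-column zero (suc (suc (suc (suc (suc (suc zero)))))) = refl
C7ℕ-power-column (suc ℓ) i =
  trans (sum-cong-≗ (λ k → cong (C7ℕ i k ℕ.*_) (C7ℕ-power-column ℓ k))) (next-atVertex (walks ℓ) i)

C7-power-column : ∀ ℓ i → (C7 ^ ℓ) i zero ≡ fromℕ (atVertex (walks ℓ) i)
C7-power-column ℓ i =
  trans (fromℕ-homo-^ C7 C7ℕ C7≡C7ℕ ℓ i zero) (cong fromℕ (C7ℕ-power-column ℓ i))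

EvenProfile OddProfile : WalkCounts → Set
EvenProfile (walkCounts w₀ w₁ w₂ w₃) = w₁ ≤ w₃ × w₃ < w₂ × w₂ ≤ w₀
OddProfile  (walkCounts w₀ w₁ w₂ w₃) = w₀ ≤ w₂ × w₂ < w₃ × w₃ ≤ w₁

next-even : ∀ w → EvenProfile w → OddProfile (next w)
next-even (walkCounts w₀ w₁ w₂ w₃) (w₁≤w₃ , w₃<w₂ , w₂≤w₀) =
  ℕ.+-monoʳ-≤ w₁ w₁≤w₃ ,
  ℕ.+-monoˡ-< w₃ (ℕ.≤-<-trans w₁≤w₃ w₃<w₂) ,
  ℕ.+-mono-≤ w₂≤w₀ (ℕ.<⇒≤ w₃<w₂)

next-odd : ∀ w → OddProfile w → EvenProfile (next w)
next-odd (walkCounts w₀ w₁ w₂ w₃) (w₀≤w₂ , w₂<w₃ , w₃≤w₁) =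
  ℕ.+-mono-≤ w₀≤w₂ (ℕ.<⇒≤ w₂<w₃) ,
  ℕ.+-monoˡ-< w₃ (ℕ.<-≤-trans w₂<w₃ w₃≤w₁) ,
  ℕ.+-monoʳ-≤ w₁ w₃≤w₁

walks-profile : ∀ n → EvenProfile (walks (2 ℕ.+ n)) ⊎ OddProfile (walks (2 ℕ.+ n))
walks-profile zero    = inj₁ (z≤n , s≤s z≤n , s≤s z≤n)
walks-profile (suc n) with walks-profile n
... | inj₁ even = inj₂ (next-even _ even)
... | inj₂ odd  = inj₁ (next-odd _ odd)

profile⇒at-2≢at-3 : ∀ {w} → EvenProfile w ⊎ OddProfile w → at-2 w ≢ at-3 w
profile⇒at-2≢at-3 {walkCounts _ _ _ _} (inj₁ (_ , w₃<w₂ , _)) w₂≡w₃ = ℕ.<-irrefl (sym w₂≡w₃) w₃<w₂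
profile⇒at-2≢at-3 {walkCounts _ _ _ _} (inj₂ (_ , w₂<w₃ , _)) w₂≡w₃ = ℕ.<-irrefl w₂≡w₃ w₂<w₃

lemma4p4 : ∀ (ℓ : ℕ) → ℓ ≥ 2 → ¬ StronglyWalkRegularAt C7 ℓ
lemma4p4 ℓ@(suc (suc n)) (s≤s (s≤s _)) swr =
  profile⇒at-2≢at-3 (walks-profile n) (fromℕ-injective (begin
    fromℕ (at-2 (walks ℓ))  ≡⟨ C7-power-column ℓ (# 2) ⟨
    (C7 ^ ℓ) (# 2) zero     ≡⟨ StronglyWalkRegularAt⇒power-agrees {A = C7} {ℓ} swr (# 2) (# 3) zero refl refl ⟩
    (C7 ^ ℓ) (# 3) zero     ≡⟨ C7-power-column ℓ (# 3) ⟩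
    fromℕ (at-3 (walks ℓ))  ∎))
  where open ≡-Reasoning
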